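{- Let $\omega(n)$ be any function with $\omega(n)\to\infty$ as $n\to\infty$. Suppose $G$ is a finite abelian group of exponent $n$, and let $A$ be a $\theta$-random subset of $[1,n-1]$ with $\theta\ge\omega(n)/\sqrt{n}$. Then with high probability (i.e. with probability tending to $1$ as $n\to\infty$), $D_A(G)\le\lfloor\log_2|G|\rfloor+1$.
   Context: For a finite abelian group $G$ (written additively) and a non-empty set $A\subseteq\mathbb{Z}\setminus\{0\}$, the weighted Davenport constant $D_A(G)$ is the least positive integer $k$ such that for every sequence $(x_1,\ldots,x_k)$ of elements of $G$ there exist a non-empty subsequence $(x_{i_1},\ldots,x_{i_t})$ and elements $a_1,\ldots,a_t\in A$ with $\sum_{j=1}^t a_jx_{i_j}=0$. For $0<\theta<1$, a $\theta$-random subset of $[a,b]=\{a,\ldots,b\}$ is a random subset obtained by including each integer $i\in[a,b]$ independently with probability $\theta$.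
   Formalization: The parameter θ ranges over the rationals in (0,1), and the function ω(n) takes rational values. -}

module Defs where

open import Level using (0ℓ)
open import Data.Nat as ℕ using (ℕ; zero; suc; _∸_)
open import Data.Nat.Logarithm using (⌊log₂_⌋)
open import Data.Integer using (+_)
open import Data.Fin using (Fin; toℕ)
import Data.Fin as F
open import Data.Fin.Subset using (Subset; _∈_; Nonempty; ∣_∣; inside; outside)
open import Data.Vec using (Vec; []; _∷_)
open import Data.List using (List; []; _∷_)
open import Data.List.Relation.Unary.All using (All)
open import Data.List.Relation.Unary.Unique.Propositional using (Unique)
open import Data.Rational using (ℚ; 0ℚ; 1ℚ; _+_; _*_; _-_; _≤_; _<_; _/_)
open import Data.Product using (Σ; ∃; _×_; _,_)
open import Relation.Binary.PropositionalEquality using (_≡_)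
open import Algebra.Structures using (IsAbelianGroup)

-- Finite abelian groups: carrier Fin m (so |G| = m), equality is _≡_.

record FinAbGroup : Set where
  field
    order  : ℕ
    _⊕_    : Fin order → Fin order → Fin order
    𝟘      : Fin order
    ⊖_     : Fin order → Fin order
    isAbGroup : IsAbelianGroup {A = Fin order} _≡_ _⊕_ 𝟘 ⊖_

module _ (G : FinAbGroup) where
  open FinAbGroup G

  Elt : Set
  Elt = Fin order

  _·_ : ℕ → Elt → Elt
  zero  · x = 𝟘
  suc a · x = x ⊕ (a · x)

  HasExponent : ℕ → Set
  HasExponent n = (0 ℕ.< n) × (∀ x → n · x ≡ 𝟘)
                × (∀ k → 0 ℕ.< k → (∀ x → k · x ≡ 𝟘) → n ℕ.≤ k)

  wsum : ∀ {k} → Subset k → (Fin k → ℕ) → (Fin k → Elt) → Elt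
  wsum {zero}  []       a x = 𝟘
  wsum {suc k} (inside  ∷ I) a x = (a F.zero · x F.zero) ⊕ wsum I (λ i → a (F.suc i)) (λ i → x (F.suc i))
  wsum {suc k} (outside ∷ I) a x = wsum I (λ i → a (F.suc i)) (λ i → x (F.suc i))

  -- Weight set A ⊆ [1, N]: encoded as a subset of Fin N, index i ↦ integer i+1.
  _∈W_ : ∀ {N} → ℕ → Subset N → Set
  a ∈W A = ∃ λ i → (i ∈ A) × (a ≡ suc (toℕ i))

  -- Every sequence of length K has a non-empty subsequence with an A-weighted zero sum.
  -- Since this property is monotone in K, D_A(G) ≤ K iff it holds at K.
  DA≤ : ∀ {N} → Subset N → ℕ → Set
  DA≤ A K = (x : Fin K → Elt) →
    Σ (Subset K) λ I → Nonempty I × Σ (Fin K → ℕ) λ a →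
      (∀ i → i ∈ I → a i ∈W A) × (wsum I a x ≡ 𝟘)

_^ℚ_ : ℚ → ℕ → ℚ
q ^ℚ zero  = 1ℚ
q ^ℚ suc k = q * (q ^ℚ k)

fromℕℚ : ℕ → ℚ
fromℕℚ n = (+ n) / 1

weight : ℚ → ∀ {N} → Subset N → ℚ
weight θ {N} A = (θ ^ℚ ∣ A ∣) * ((1ℚ - θ) ^ℚ (N ∸ ∣ A ∣))

sumW : ℚ → ∀ {N} → List (Subset N) → ℚ
sumW θ []       = 0ℚ
sumW θ (A ∷ As) = weight θ A + sumW θ As

-- P(event E) ≥ p for the θ-random subset of [1,N]: the event contains a
-- (duplicate-free) collection of outcomes of total probability ≥ p.
ProbAtLeast : ℚ → (N : ℕ) → (Subset N → Set) → ℚ → Set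
ProbAtLeast θ N E p =
  Σ (List (Subset N)) λ S → Unique S × All E S × (p ≤ sumW θ S)

module Submission where

-- Write n = N + 1 and N = 2k + m with m ≤ 1, and pair the weights
-- of [1, N] into the k "frames" {i, n - i}, i = 1, ..., k.
--  * Combinatorics: if the weight set A contains a, b with a + b = n, then
--    D_A(G) ≤ ⌊log₂|G|⌋ + 1.  For a sequence of length K = ⌊log₂|G|⌋ + 1 there
--    are 2^K > |G| subsequences, so two of them, I ≠ J, have the same sum s;
--    weighting I Δ J by a on I and by b on J gives a·s + b·s = n·s = 0.
--  * Probability: the θ-random sets containing both ends of some frame are
--    listed explicitly (outermost frame first); they have total weight
--    1 - (1 - θ²)^k.
--  * Estimates: Bernoulli's inequality gives (1 - θ²)^k · θ² n ≤ 2, hence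
--    (1 - θ²)^k ≤ ε as soon as ω ≥ 2/ε + 1 and ω² ≤ θ² n.

open import Defs
open import Level using (0ℓ)
open import Function using (_∘_)
open import Data.Empty using (⊥; ⊥-elim)
open import Data.Nat as ℕ using (ℕ; zero; suc; _∸_)
import Data.Nat.Properties as ℕP
import Data.Nat.Coprimality as Coprimality
open import Data.Nat.Logarithm using (⌊log₂_⌋; ⌊log₂⌋-mono-≤; ⌊log₂[2^n]⌋≡n)
import Data.Integer as ℤ
open ℤ using () renaming (+_ to ⁺)
import Data.Integer.Properties as ℤP
open import Data.Fin as F using (Fin; toℕ)
import Data.Fin.Properties as FP
open import Data.Fin.Subset using (Subset; _∈_; Nonempty; ∣_∣)
open import Data.Fin.Subset.Properties using (∣p∣≤n)
open import Data.Vec as V using ([]; _∷_; _∷ʳ_; last; lookup; zipWith; here; there)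
import Data.Vec.Properties as VP
open import Data.Bool using (Bool; true; false; if_then_else_; _xor_)
open import Data.List as L using (List; []; _∷_; _++_)
open import Data.List.Relation.Unary.All as All using (All; []; _∷_)
import Data.List.Relation.Unary.All.Properties as AllP
open import Data.List.Relation.Unary.Any using (here; there)
open import Data.List.Relation.Unary.Unique.Propositional using (Unique)
import Data.List.Relation.Unary.Unique.Propositional.Properties as UniqueP
open import Data.List.Relation.Unary.AllPairs using ([]; _∷_)
open import Data.List.Membership.Propositional using () renaming (_∈_ to _∈ₗ_)
import Data.List.Membership.Propositional.Properties as MemP
open import Data.Rational as ℚ using (ℚ; 0ℚ; 1ℚ; _+_; _*_; _-_; _≤_; _<_; 1/_)
import Data.Rational.Properties as ℚP
open import Data.Rational.Solver using (module +-*-Solver)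
open import Data.Product using (Σ; ∃; ∃₂; _×_; _,_)
open import Data.Sum using (_⊎_; inj₁; inj₂)
open import Relation.Binary.PropositionalEquality
open import Relation.Nullary.Decidable using (toWitness)
open import Algebra.Bundles using (CommutativeMonoid)
open import Algebra.Structures using (IsAbelianGroup)
import Algebra.Properties.CommutativeMonoid.Mult as MonoidMult
import Algebra.Properties.CommutativeSemigroup as CommSemigroupProps
open +-*-Solver

ComplementaryPair : ℕ → ∀ {N} → Subset N → Set
ComplementaryPair n {N} A =
  ∃₂ λ (i j : Fin N) → i ∈ A × j ∈ A × suc (toℕ i) ℕ.+ suc (toℕ j) ≡ n

toBit : Fin 2 → Bool
toBit F.zero    = false
toBit (F.suc _) = true

toBit-injective : ∀ {i j} → toBit i ≡ toBit j → i ≡ j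
toBit-injective {F.zero}        {F.zero}        _  = refl
toBit-injective {F.suc F.zero}  {F.suc F.zero}  _  = refl
toBit-injective {F.zero}        {F.suc F.zero}  ()
toBit-injective {F.suc F.zero}  {F.zero}        ()

-- An injective enumeration of the subsets of Fin K by Fin 2^K, through the
-- mixed-radix decomposition Fin (2 * m) ≅ Fin 2 × Fin m.
subsetCode : ∀ K → Fin (2 ℕ.^ K) → Subset K
subsetCode zero    _ = []
subsetCode (suc K) i = toBit (F.quotient (2 ℕ.^ K) i) ∷ subsetCode K (F.remainder {2} (2 ℕ.^ K) i)

subsetCode-injective : ∀ K {i j} → subsetCode K i ≡ subsetCode K j → i ≡ j
subsetCode-injective zero    {F.zero} {F.zero} _ = refl
subsetCode-injective (suc K) {i} {j} e = begin
  i                                           ≡⟨ FP.combine-remQuot {2} (2 ℕ.^ K) i ⟨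
  F.combine (F.quotient (2 ℕ.^ K) i) (F.remainder {2} (2 ℕ.^ K) i)
    ≡⟨ cong₂ F.combine (toBit-injective (VP.∷-injectiveˡ e))
                       (subsetCode-injective K (VP.∷-injectiveʳ e)) ⟩
  F.combine (F.quotient (2 ℕ.^ K) j) (F.remainder {2} (2 ℕ.^ K) j)
                                              ≡⟨ FP.combine-remQuot {2} (2 ℕ.^ K) j ⟩
  j                                           ∎
  where open ≡-Reasoning

<2^[⌊log₂⌋+1] : ∀ m → m ℕ.< 2 ℕ.^ (⌊log₂ m ⌋ ℕ.+ 1)
<2^[⌊log₂⌋+1] m = ℕP.≰⇒> λ 2^L+1≤m → ℕP.n≮n L (begin-strict
  L                       <⟨ ℕP.n<1+n L ⟩
  suc L                   ≡⟨ ℕP.+-comm 1 L ⟩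
  L ℕ.+ 1                 ≡⟨ ⌊log₂[2^n]⌋≡n (L ℕ.+ 1) ⟨
  ⌊log₂ 2 ℕ.^ (L ℕ.+ 1) ⌋ ≤⟨ ⌊log₂⌋-mono-≤ 2^L+1≤m ⟩
  L                       ∎)
  where
    L = ⌊log₂ m ⌋
    open ℕP.≤-Reasoning

_Δ_ : ∀ {K} → Subset K → Subset K → Subset K
_Δ_ = zipWith _xor_

Δ-nonempty : ∀ {K} (I J : Subset K) → I ≢ J → Nonempty (I Δ J)
Δ-nonempty []          []          I≢J = ⊥-elim (I≢J refl)
Δ-nonempty (true  ∷ I) (false ∷ J) _   = F.zero , here
Δ-nonempty (false ∷ I) (true  ∷ J) _   = F.zero , here
Δ-nonempty (true  ∷ I) (true  ∷ J) I≢J =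
  let (i , i∈) = Δ-nonempty I J (I≢J ∘ cong (true ∷_)) in F.suc i , there i∈
Δ-nonempty (false ∷ I) (false ∷ J) I≢J =
  let (i , i∈) = Δ-nonempty I J (I≢J ∘ cong (false ∷_)) in F.suc i , there i∈

module _ (G : FinAbGroup) where
  open FinAbGroup G
  open IsAbelianGroup isAbGroup using (isCommutativeMonoid; assoc; identityˡ)

  commutativeMonoid : CommutativeMonoid 0ℓ 0ℓ
  commutativeMonoid = record { isCommutativeMonoid = isCommutativeMonoid }

  open MonoidMult commutativeMonoid using (×-homo-+; ×-distrib-+)
    renaming (_×_ to _×ᴹ_)
  open CommSemigroupProps (CommutativeMonoid.commutativeSemigroup commutativeMonoid)
    using (interchange; x∙yz≈y∙xz)

  infixr 30 _·ᴳ_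
  private
    _·ᴳ_ : ℕ → Elt G → Elt G
    _·ᴳ_ = _·_ G

  -- The multiples a·x of the statement are the library's monoid multiples;
  -- through this, a·x is additive in a and distributes over ⊕.
  ·≗× : ∀ a x → a ·ᴳ x ≡ a ×ᴹ x
  ·≗× zero    x = refl
  ·≗× (suc a) x = cong (x ⊕_) (·≗× a x)

  ·-distrib-⊕ : ∀ a x y → a ·ᴳ (x ⊕ y) ≡ (a ·ᴳ x) ⊕ (a ·ᴳ y)
  ·-distrib-⊕ a x y rewrite ·≗× a (x ⊕ y) | ·≗× a x | ·≗× a y = ×-distrib-+ x y a

  ·-homo-+ : ∀ a b x → (a ℕ.+ b) ·ᴳ x ≡ (a ·ᴳ x) ⊕ (b ·ᴳ x)
  ·-homo-+ a b x rewrite ·≗× (a ℕ.+ b) x | ·≗× a x | ·≗× b x = ×-homo-+ x a b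

  subsetSum : ∀ {K} → Subset K → (Fin K → Elt G) → Elt G
  subsetSum []          x = 𝟘
  subsetSum (true  ∷ I) x = x F.zero ⊕ subsetSum I (x ∘ F.suc)
  subsetSum (false ∷ I) x = subsetSum I (x ∘ F.suc)

  subsetSum-collision : ∀ {K} → order ℕ.< 2 ℕ.^ K → (x : Fin K → Elt G) →
    ∃₂ λ I J → I ≢ J × subsetSum I x ≡ subsetSum J x
  subsetSum-collision {K} |G|<2^K x =
    let (i , j , i<j , same) = FP.pigeonhole |G|<2^K (λ c → subsetSum (subsetCode K c) x)
    in subsetCode K i , subsetCode K j , FP.<⇒≢ i<j ∘ subsetCode-injective K , same

  choose : ℕ → ℕ → ∀ {K} → Subset K → Fin K → ℕ
  choose a b I i = if lookup I i then a else b

  module _ (a b : ℕ) (a+b≡0 : ∀ y → (a ℕ.+ b) ·ᴳ y ≡ 𝟘) where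

    in-both : ∀ x₀ s t → a ·ᴳ (x₀ ⊕ s) ⊕ b ·ᴳ (x₀ ⊕ t) ≡ a ·ᴳ s ⊕ b ·ᴳ t
    in-both x₀ s t = begin
      a ·ᴳ (x₀ ⊕ s) ⊕ b ·ᴳ (x₀ ⊕ t)          ≡⟨ cong₂ _⊕_ (·-distrib-⊕ a x₀ s) (·-distrib-⊕ b x₀ t) ⟩
      (a ·ᴳ x₀ ⊕ a ·ᴳ s) ⊕ (b ·ᴳ x₀ ⊕ b ·ᴳ t) ≡⟨ interchange _ _ _ _ ⟩
      (a ·ᴳ x₀ ⊕ b ·ᴳ x₀) ⊕ (a ·ᴳ s ⊕ b ·ᴳ t) ≡⟨ cong (_⊕ (a ·ᴳ s ⊕ b ·ᴳ t)) (·-homo-+ a b x₀) ⟨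
      (a ℕ.+ b) ·ᴳ x₀ ⊕ (a ·ᴳ s ⊕ b ·ᴳ t)     ≡⟨ cong (_⊕ (a ·ᴳ s ⊕ b ·ᴳ t)) (a+b≡0 x₀) ⟩
      𝟘 ⊕ (a ·ᴳ s ⊕ b ·ᴳ t)                  ≡⟨ identityˡ _ ⟩
      a ·ᴳ s ⊕ b ·ᴳ t                        ∎
      where open ≡-Reasoning

    in-I-only : ∀ x₀ s t → a ·ᴳ (x₀ ⊕ s) ⊕ b ·ᴳ t ≡ a ·ᴳ x₀ ⊕ (a ·ᴳ s ⊕ b ·ᴳ t)
    in-I-only x₀ s t = trans (cong (_⊕ b ·ᴳ t) (·-distrib-⊕ a x₀ s)) (assoc _ _ _)

    in-J-only : ∀ x₀ s t → a ·ᴳ s ⊕ b ·ᴳ (x₀ ⊕ t) ≡ b ·ᴳ x₀ ⊕ (a ·ᴳ s ⊕ b ·ᴳ t)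
    in-J-only x₀ s t = trans (cong (a ·ᴳ s ⊕_) (·-distrib-⊕ b x₀ t)) (x∙yz≈y∙xz _ _ _)

    -- Weighting I Δ J by a on I and by b on J computes a·ΣI + b·ΣJ, since
    -- on I ∩ J the two weights cancel.
    Δ-weighted-sum : ∀ {K} (I J : Subset K) x →
      wsum G (I Δ J) (choose a b I) x ≡ a ·ᴳ subsetSum I x ⊕ b ·ᴳ subsetSum J x
    Δ-weighted-sum [] [] x = begin
      𝟘                   ≡⟨ a+b≡0 𝟘 ⟨
      (a ℕ.+ b) ·ᴳ 𝟘      ≡⟨ ·-homo-+ a b 𝟘 ⟩
      a ·ᴳ 𝟘 ⊕ b ·ᴳ 𝟘     ∎
      where open ≡-Reasoning
    Δ-weighted-sum (true ∷ I) (true ∷ J) x =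
      trans (Δ-weighted-sum I J (x ∘ F.suc)) (sym (in-both (x F.zero) _ _))
    Δ-weighted-sum (true ∷ I) (false ∷ J) x =
      trans (cong (a ·ᴳ x F.zero ⊕_) (Δ-weighted-sum I J (x ∘ F.suc))) (sym (in-I-only (x F.zero) _ _))
    Δ-weighted-sum (false ∷ I) (true ∷ J) x =
      trans (cong (b ·ᴳ x F.zero ⊕_) (Δ-weighted-sum I J (x ∘ F.suc))) (sym (in-J-only (x F.zero) _ _))
    Δ-weighted-sum (false ∷ I) (false ∷ J) x =
      Δ-weighted-sum I J (x ∘ F.suc)

  DA≤-of-complementaryPair : ∀ n → (∀ y → n ·ᴳ y ≡ 𝟘) → ∀ {N} (A : Subset N) →
    ComplementaryPair n A → DA≤ G A (⌊log₂ order ⌋ ℕ.+ 1)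
  DA≤-of-complementaryPair n n·G≡0 A (i , j , i∈A , j∈A , a+b≡n) x =
    let (I , J , I≢J , sameSum) = subsetSum-collision (<2^[⌊log₂⌋+1] order) x
    in I Δ J , Δ-nonempty I J I≢J , choose a b I , (λ l _ → chosen-in-A I l) , (begin
         wsum G (I Δ J) (choose a b I) x        ≡⟨ Δ-weighted-sum a b a+b≡0 I J x ⟩
         a ·ᴳ subsetSum I x ⊕ b ·ᴳ subsetSum J x ≡⟨ cong (λ s → a ·ᴳ subsetSum I x ⊕ b ·ᴳ s) sameSum ⟨
         a ·ᴳ subsetSum I x ⊕ b ·ᴳ subsetSum I x ≡⟨ ·-homo-+ a b (subsetSum I x) ⟨
         (a ℕ.+ b) ·ᴳ subsetSum I x             ≡⟨ a+b≡0 (subsetSum I x) ⟩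
         𝟘                                      ∎)
    where
      open ≡-Reasoning
      a = suc (toℕ i)
      b = suc (toℕ j)
      a+b≡0 : ∀ y → (a ℕ.+ b) ·ᴳ y ≡ 𝟘
      a+b≡0 y = trans (cong (_·ᴳ y) a+b≡n) (n·G≡0 y)
      chosen-in-A : ∀ {K} (I : Subset K) l → _∈W_ G (choose a b I l) A
      chosen-in-A I l with lookup I l
      ... | true  = i , i∈A , refl
      ... | false = j , j∈A , refl

coin : ℚ → Bool → ℚ
coin θ true  = θ
coin θ false = 1ℚ - θ

weight-∷ : ∀ θ {N} b (A : Subset N) → weight θ (b ∷ A) ≡ coin θ b * weight θ A
weight-∷ θ true A = ℚP.*-assoc θ _ _
weight-∷ θ {N} false A = begin
  (θ ^ℚ ∣ A ∣) * ((1ℚ - θ) ^ℚ (suc N ∸ ∣ A ∣))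
    ≡⟨ cong (λ e → (θ ^ℚ ∣ A ∣) * ((1ℚ - θ) ^ℚ e)) (ℕP.+-∸-assoc 1 (∣p∣≤n A)) ⟩
  (θ ^ℚ ∣ A ∣) * ((1ℚ - θ) * ((1ℚ - θ) ^ℚ (N ∸ ∣ A ∣)))
    ≡⟨ solve 3 (λ x y z → x :* (y :* z) := y :* (x :* z)) refl (θ ^ℚ ∣ A ∣) (1ℚ - θ) _ ⟩
  (1ℚ - θ) * weight θ A ∎
  where open ≡-Reasoning

weight-∷ʳ : ∀ θ {N} (A : Subset N) c → weight θ (A ∷ʳ c) ≡ weight θ A * coin θ c
weight-∷ʳ θ []      c = trans (weight-∷ θ c []) (ℚP.*-comm (coin θ c) 1ℚ)
weight-∷ʳ θ (b ∷ A) c = begin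
  weight θ (b ∷ (A ∷ʳ c))          ≡⟨ weight-∷ θ b (A ∷ʳ c) ⟩
  coin θ b * weight θ (A ∷ʳ c)     ≡⟨ cong (coin θ b *_) (weight-∷ʳ θ A c) ⟩
  coin θ b * (weight θ A * coin θ c) ≡⟨ ℚP.*-assoc (coin θ b) _ _ ⟨
  (coin θ b * weight θ A) * coin θ c ≡⟨ cong (_* coin θ c) (weight-∷ θ b A) ⟨
  weight θ (b ∷ A) * coin θ c      ∎
  where open ≡-Reasoning

sumW-++ : ∀ θ {N} (X Y : List (Subset N)) → sumW θ (X ++ Y) ≡ sumW θ X + sumW θ Y
sumW-++ θ []      Y = sym (ℚP.+-identityˡ _)
sumW-++ θ (A ∷ X) Y = trans (cong (weight θ A +_) (sumW-++ θ X Y)) (sym (ℚP.+-assoc (weight θ A) _ _))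

sumW-map : ∀ θ {N M} (f : Subset N → Subset M) c → (∀ A → weight θ (f A) ≡ c * weight θ A) →
  ∀ As → sumW θ (L.map f As) ≡ c * sumW θ As
sumW-map θ f c scale []       = sym (ℚP.*-zeroʳ c)
sumW-map θ f c scale (A ∷ As) =
  trans (cong₂ _+_ (scale A) (sumW-map θ f c scale As)) (sym (ℚP.*-distribˡ-+ c _ _))

allSubsets : ∀ s → List (Subset s)
allSubsets zero    = [] ∷ []
allSubsets (suc s) = L.map (true ∷_) (allSubsets s) ++ L.map (false ∷_) (allSubsets s)

allSubsets-unique : ∀ s → Unique (allSubsets s)
allSubsets-unique zero    = [] ∷ []
allSubsets-unique (suc s) =
  UniqueP.++⁺ (UniqueP.map⁺ VP.∷-injectiveʳ (allSubsets-unique s))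
              (UniqueP.map⁺ VP.∷-injectiveʳ (allSubsets-unique s))
              (λ (inT , inF) → heads-differ inT inF)
  where
    heads-differ : ∀ {A} → A ∈ₗ L.map (true ∷_) (allSubsets s) → A ∈ₗ L.map (false ∷_) (allSubsets s) → ⊥
    heads-differ inT inF with MemP.∈-map⁻ (true ∷_) inT | MemP.∈-map⁻ (false ∷_) inF
    ... | _ , _ , refl | _ , _ , ()

sumW-allSubsets : ∀ θ s → sumW θ (allSubsets s) ≡ 1ℚ
sumW-allSubsets θ zero    = ℚP.+-identityʳ 1ℚ
sumW-allSubsets θ (suc s) = begin
  sumW θ (L.map (true ∷_) all ++ L.map (false ∷_) all)
    ≡⟨ sumW-++ θ (L.map (true ∷_) all) _ ⟩
  sumW θ (L.map (true ∷_) all) + sumW θ (L.map (false ∷_) all)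
    ≡⟨ cong₂ _+_ (sumW-map θ (true ∷_) θ (weight-∷ θ true) all)
                 (sumW-map θ (false ∷_) (1ℚ - θ) (weight-∷ θ false) all) ⟩
  θ * sumW θ all + (1ℚ - θ) * sumW θ all
    ≡⟨ cong (λ w → θ * w + (1ℚ - θ) * w) (sumW-allSubsets θ s) ⟩
  θ * 1ℚ + (1ℚ - θ) * 1ℚ
    ≡⟨ solve 1 (λ t → t :* con 1ℚ :+ (con 1ℚ :- t) :* con 1ℚ := con 1ℚ) refl θ ⟩
  1ℚ ∎
  where
    open ≡-Reasoning
    all = allSubsets s

-- Subsets of [1, s+2] are explored from the outside in: the two end points
-- 1 and s+2 form a frame, recorded by their membership flags, around a subset
-- of the s points in between.
Frame : Set
Frame = Bool × Bool

frame : ∀ {s} → Frame → Subset s → Subset (suc (suc s))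
frame (b , c) A = b ∷ (A ∷ʳ c)

frameWeight : ℚ → Frame → ℚ
frameWeight θ (b , c) = coin θ b * coin θ c

weight-frame : ∀ θ {s} p (A : Subset s) → weight θ (frame p A) ≡ frameWeight θ p * weight θ A
weight-frame θ (b , c) A = begin
  weight θ (b ∷ (A ∷ʳ c))            ≡⟨ weight-∷ θ b (A ∷ʳ c) ⟩
  coin θ b * weight θ (A ∷ʳ c)       ≡⟨ cong (coin θ b *_) (weight-∷ʳ θ A c) ⟩
  coin θ b * (weight θ A * coin θ c) ≡⟨ solve 3 (λ x y z → x :* (y :* z) := (x :* z) :* y) refl (coin θ b) _ (coin θ c) ⟩
  coin θ b * coin θ c * weight θ A   ∎
  where open ≡-Reasoning

ends : ∀ {s} → Subset (suc (suc s)) → Frame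
ends (b ∷ A) = b , last A

ends-frame : ∀ {s} p (A : Subset s) → ends (frame p A) ≡ p
ends-frame (b , c) A = cong (b ,_) (VP.last-∷ʳ c A)

frame-injective : ∀ {s} p {A A′ : Subset s} → frame p A ≡ frame p A′ → A ≡ A′
frame-injective (b , c) {A} {A′} e = VP.∷ʳ-injectiveˡ A A′ (VP.∷-injectiveʳ e)

framed : ∀ {s} → List Frame → (Frame → List (Subset s)) → List (Subset (suc (suc s)))
framed []       inner = []
framed (p ∷ ps) inner = L.map (frame p) (inner p) ++ framed ps inner

ends-framed : ∀ {s} ps (inner : Frame → List (Subset s)) {A} → A ∈ₗ framed ps inner → ends A ∈ₗ ps
ends-framed (p ∷ ps) inner A∈ with MemP.∈-++⁻ (L.map (frame p) (inner p)) A∈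
... | inj₂ A∈rest = there (ends-framed ps inner A∈rest)
... | inj₁ A∈here with MemP.∈-map⁻ (frame p) A∈here
...   | B , _ , refl = here (ends-frame p B)

-- Distinct frames give disjoint blocks, so the list is duplicate-free.
framed-unique : ∀ {s} ps (inner : Frame → List (Subset s)) →
  Unique ps → (∀ p → Unique (inner p)) → Unique (framed ps inner)
framed-unique []       inner []           _        = []
framed-unique (p ∷ ps) inner (p∉ps ∷ ups) uinner =
  UniqueP.++⁺ (UniqueP.map⁺ (frame-injective p) (uinner p)) (framed-unique ps inner ups uinner)
    λ (A∈here , A∈rest) → All.lookup p∉ps
      (subst (_∈ₗ ps) (ends-here A∈here) (ends-framed ps inner A∈rest)) refl
  where
    ends-here : ∀ {A} → A ∈ₗ L.map (frame p) (inner p) → ends A ≡ p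
    ends-here A∈ with MemP.∈-map⁻ (frame p) A∈
    ... | B , _ , refl = ends-frame p B

framed-all : ∀ {s} {P : Subset (suc (suc s)) → Set} ps (inner : Frame → List (Subset s)) →
  (∀ p → All (P ∘ frame p) (inner p)) → All P (framed ps inner)
framed-all []       inner Pinner = []
framed-all (p ∷ ps) inner Pinner = AllP.++⁺ (AllP.map⁺ (Pinner p)) (framed-all ps inner Pinner)

sumℚ : List ℚ → ℚ
sumℚ = L.foldr _+_ 0ℚ

sumW-framed : ∀ θ {s} ps (inner : Frame → List (Subset s)) →
  sumW θ (framed ps inner) ≡ sumℚ (L.map (λ p → frameWeight θ p * sumW θ (inner p)) ps)
sumW-framed θ []       inner = refl
sumW-framed θ (p ∷ ps) inner =
  trans (sumW-++ θ (L.map (frame p) (inner p)) _)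
        (cong₂ _+_ (sumW-map θ (frame p) (frameWeight θ p) (weight-frame θ p) (inner p))
                   (sumW-framed θ ps inner))

width : ℕ → ℕ → ℕ
width zero    m = m
width (suc k) m = suc (suc (width k m))

allFrames : List Frame
allFrames = (true , true) ∷ (true , false) ∷ (false , true) ∷ (false , false) ∷ []

allFrames-unique : Unique allFrames
allFrames-unique = ((λ ()) ∷ (λ ()) ∷ (λ ()) ∷ []) ∷ ((λ ()) ∷ (λ ()) ∷ []) ∷ ((λ ()) ∷ []) ∷ [] ∷ []

goodInside : ∀ {s} → List (Subset s) → Frame → List (Subset s)
goodInside _         (true , true) = allSubsets _
goodInside goodInner _             = goodInner

-- The subsets of [1, 2k+m] containing both ends i and 2k+m+1-i of one of
-- the k outer frames, each listed once.
good : ∀ k m → List (Subset (width k m))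
good zero    m = []
good (suc k) m = framed allFrames (goodInside (good k m))

good-unique : ∀ k m → Unique (good k m)
good-unique zero    m = []
good-unique (suc k) m = framed-unique allFrames _ allFrames-unique inside-unique
  where
    inside-unique : ∀ p → Unique (goodInside (good k m) p)
    inside-unique (true  , true)  = allSubsets-unique _
    inside-unique (true  , false) = good-unique k m
    inside-unique (false , true)  = good-unique k m
    inside-unique (false , false) = good-unique k m

-- The full frame has weight θ², the three others together 1 - θ².
sumW-framed-goodInside : ∀ θ {s} (Y : List (Subset s)) →
  sumW θ (framed allFrames (goodInside Y)) ≡ θ * θ + (1ℚ - θ * θ) * sumW θ Y
sumW-framed-goodInside θ {s} Y = begin
  sumW θ (framed allFrames (goodInside Y))
    ≡⟨ sumW-framed θ allFrames (goodInside Y) ⟩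
  θ * θ * sumW θ (allSubsets s) + rest
    ≡⟨ cong (λ u → θ * θ * u + rest) (sumW-allSubsets θ s) ⟩
  θ * θ * 1ℚ + rest
    ≡⟨ solve 2 (λ t w → t :* t :* con 1ℚ :+ (t :* (con 1ℚ :- t) :* w :+ ((con 1ℚ :- t) :* t :* w
                 :+ ((con 1ℚ :- t) :* (con 1ℚ :- t) :* w :+ con 0ℚ))) := t :* t :+ (con 1ℚ :- t :* t) :* w) refl θ w ⟩
  θ * θ + (1ℚ - θ * θ) * w ∎
  where
    open ≡-Reasoning
    w = sumW θ Y
    rest = θ * (1ℚ - θ) * w + ((1ℚ - θ) * θ * w + ((1ℚ - θ) * (1ℚ - θ) * w + 0ℚ))

sumW-good : ∀ θ k m → sumW θ (good k m) ≡ 1ℚ - (1ℚ - θ * θ) ^ℚ k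
sumW-good θ zero    m = sym (ℚP.+-inverseʳ 1ℚ)
sumW-good θ (suc k) m = begin
  sumW θ (framed allFrames (goodInside (good k m))) ≡⟨ sumW-framed-goodInside θ (good k m) ⟩
  θ * θ + (1ℚ - θ * θ) * sumW θ (good k m)          ≡⟨ cong (λ w → θ * θ + (1ℚ - θ * θ) * w) (sumW-good θ k m) ⟩
  θ * θ + (1ℚ - θ * θ) * (1ℚ - P)                   ≡⟨ solve 2 (λ t P → t :+ (con 1ℚ :- t) :* (con 1ℚ :- P)
                                                          := con 1ℚ :- (con 1ℚ :- t) :* P) refl (θ * θ) P ⟩
  1ℚ - (1ℚ - θ * θ) * P                             ∎
  where
    open ≡-Reasoning
    P = (1ℚ - θ * θ) ^ℚ k

both-ends-pair : ∀ {s} (A : Subset s) → ComplementaryPair (suc (suc (suc s))) (frame (true , true) A)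
both-ends-pair {s} A =
  F.zero , F.fromℕ (suc s) , here , there (last-index A) , cong (suc ∘ suc ∘ suc) (FP.toℕ-fromℕ s)
  where
    last-index : ∀ {r} (B : Subset r) → (B ∷ʳ true) V.[ F.fromℕ r ]= true
    last-index []      = here
    last-index (_ ∷ B) = there (last-index B)

frame-pair : ∀ {s} p (A : Subset s) → ComplementaryPair (suc s) A →
  ComplementaryPair (suc (suc (suc s))) (frame p A)
frame-pair (b , c) A (i , j , i∈A , j∈A , i+j) =
  F.suc (F.inject₁ i) , F.suc (F.inject₁ j) , there (inner-index i∈A) , there (inner-index j∈A) , weights-sum
  where
    inner-index : ∀ {r} {B : Subset r} {l} → B V.[ l ]= true → (B ∷ʳ c) V.[ F.inject₁ l ]= true
    inner-index here        = here
    inner-index (there l∈B) = there (inner-index l∈B)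
    weights-sum : suc (suc (toℕ (F.inject₁ i))) ℕ.+ suc (suc (toℕ (F.inject₁ j))) ≡ suc (suc (suc _))
    weights-sum rewrite FP.toℕ-inject₁ i | FP.toℕ-inject₁ j =
      cong suc (trans (ℕP.+-suc (suc (toℕ i)) (suc (toℕ j))) (cong suc i+j))

good-pairs : ∀ k m → All (ComplementaryPair (suc (width k m))) (good k m)
good-pairs zero    m = []
good-pairs (suc k) m = framed-all allFrames (goodInside (good k m)) inside-pairs
  where
    inside-pairs : ∀ p → All (ComplementaryPair (suc (width (suc k) m)) ∘ frame p) (goodInside (good k m) p)
    inside-pairs (true  , true)  = All.universal both-ends-pair _
    inside-pairs (true  , false) = All.map (frame-pair _ _) (good-pairs k m)
    inside-pairs (false , true)  = All.map (frame-pair _ _) (good-pairs k m)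
    inside-pairs (false , false) = All.map (frame-pair _ _) (good-pairs k m)

fromℕℚ-suc : ∀ n → fromℕℚ (suc n) ≡ 1ℚ + fromℕℚ n
fromℕℚ-suc n = begin
  fromℕℚ (suc n)                       ≡⟨ ℚP./-cong {p₁ = ⁺ (suc n)} {q₁ = 1}
                                            (cong (ℤ._+_ (⁺ 1)) (sym (ℤP.*-identityʳ (⁺ n)))) refl ⟩
  1ℚ + ℚ.mkℚ (⁺ n) 0 n/1-coprime     ≡⟨ cong (1ℚ +_) (ℚP.normalize-coprime n/1-coprime) ⟨
  1ℚ + fromℕℚ n                        ∎
  where
    open ≡-Reasoning
    n/1-coprime = Coprimality.sym (Coprimality.1-coprimeTo n)

-- Elementary facts about the order of ℚ, phrased with 0 ≤ _ instead of the
-- library's NonNegative instances.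
fromℕℚ-nonneg : ∀ n → 0ℚ ≤ fromℕℚ n
fromℕℚ-nonneg n = ℚP.nonNegative⁻¹ _ {{ℚP.normalize-nonNeg n 1}}

0≤1 : 0ℚ ≤ 1ℚ
0≤1 = toWitness {a? = 0ℚ ℚP.≤? 1ℚ} _

*-nonneg : ∀ {p q} → 0ℚ ≤ p → 0ℚ ≤ q → 0ℚ ≤ p * q
*-nonneg {p} {q} 0≤p 0≤q =
  ℚP.nonNegative⁻¹ _ {{ℚP.nonNeg*nonNeg⇒nonNeg p {{ℚ.nonNegative 0≤p}} q {{ℚ.nonNegative 0≤q}}}}

*-monoˡ : ∀ {r p q} → 0ℚ ≤ r → p ≤ q → r * p ≤ r * q
*-monoˡ {r} 0≤r = ℚP.*-monoˡ-≤-nonNeg r {{ℚ.nonNegative 0≤r}}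

≤-+-nonneg : ∀ p {q} → 0ℚ ≤ q → p ≤ p + q
≤-+-nonneg p {q} 0≤q = subst (_≤ p + q) (ℚP.+-identityʳ p) (ℚP.+-monoʳ-≤ p 0≤q)

pow-nonneg : ∀ {q} → 0ℚ ≤ q → ∀ k → 0ℚ ≤ q ^ℚ k
pow-nonneg 0≤q zero    = 0≤1
pow-nonneg 0≤q (suc k) = *-nonneg 0≤q (pow-nonneg 0≤q k)

1-nonneg : ∀ {t} → t ≤ 1ℚ → 0ℚ ≤ 1ℚ - t
1-nonneg {t} t≤1 = subst (_≤ 1ℚ - t) (ℚP.+-inverseʳ t) (ℚP.+-monoˡ-≤ (ℚ.- t) t≤1)

bernoulli : ∀ {t} → 0ℚ ≤ t → t ≤ 1ℚ → ∀ k → (1ℚ - t) ^ℚ k * (1ℚ + fromℕℚ k * t) ≤ 1ℚ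
bernoulli {t} 0≤t t≤1 zero    =
  ℚP.≤-reflexive (solve 1 (λ t → con 1ℚ :* (con 1ℚ :+ con 0ℚ :* t) := con 1ℚ) refl t)
bernoulli {t} 0≤t t≤1 (suc k) = begin
  (1ℚ - t) * P * (1ℚ + fromℕℚ (suc k) * t)
    ≡⟨ cong (λ e → (1ℚ - t) * P * (1ℚ + e * t)) (fromℕℚ-suc k) ⟩
  (1ℚ - t) * P * (1ℚ + (1ℚ + e) * t)
    ≤⟨ ≤-+-nonneg _ (*-nonneg P≥0 (*-nonneg (*-nonneg 0≤t 0≤t) 0≤1+e)) ⟩
  (1ℚ - t) * P * (1ℚ + (1ℚ + e) * t) + P * (t * t * (1ℚ + e))
    ≡⟨ solve 3 (λ t P e → (con 1ℚ :- t) :* P :* (con 1ℚ :+ (con 1ℚ :+ e) :* t) :+ P :* (t :* t :* (con 1ℚ :+ e))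
                         := P :* (con 1ℚ :+ e :* t)) refl t P e ⟩
  P * (1ℚ + e * t)
    ≤⟨ bernoulli 0≤t t≤1 k ⟩
  1ℚ ∎
  where
    open ℚP.≤-Reasoning
    P = (1ℚ - t) ^ℚ k
    e = fromℕℚ k
    P≥0 = pow-nonneg (1-nonneg t≤1) k
    0≤1+e = subst (0ℚ ≤_) (fromℕℚ-suc k) (fromℕℚ-nonneg (suc k))

-- The constant 2, in a form the ring solver treats as a constant.
two : ℚ
two = 1ℚ + 1ℚ

0≤two : 0ℚ ≤ two
0≤two = toWitness {a? = 0ℚ ℚP.≤? two} _

width-bound : ∀ k m → m ℕ.≤ 1 → fromℕℚ (suc (width k m)) ≤ two * (1ℚ + fromℕℚ k)
width-bound zero zero          _ = toWitness {a? = fromℕℚ 1 ℚP.≤? two * (1ℚ + 0ℚ)} _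
width-bound zero (suc zero)    _ = ℚP.≤-refl
width-bound zero (suc (suc _)) (ℕ.s≤s ())
width-bound (suc k) m m≤1 = begin
  fromℕℚ (suc (suc (suc (width k m))))
    ≡⟨ trans (fromℕℚ-suc (suc (suc (width k m)))) (cong (1ℚ +_) (fromℕℚ-suc (suc (width k m)))) ⟩
  1ℚ + (1ℚ + fromℕℚ (suc (width k m)))
    ≤⟨ ℚP.+-monoʳ-≤ 1ℚ (ℚP.+-monoʳ-≤ 1ℚ (width-bound k m m≤1)) ⟩
  1ℚ + (1ℚ + two * (1ℚ + fromℕℚ k))
    ≡⟨ solve 1 (λ e → con 1ℚ :+ (con 1ℚ :+ con two :* (con 1ℚ :+ e)) := con two :* (con 1ℚ :+ (con 1ℚ :+ e))) refl (fromℕℚ k) ⟩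
  two * (1ℚ + (1ℚ + fromℕℚ k))
    ≡⟨ cong (λ e → two * (1ℚ + e)) (fromℕℚ-suc k) ⟨
  two * (1ℚ + fromℕℚ (suc k)) ∎
  where open ℚP.≤-Reasoning

tail-bound : ∀ {t} → 0ℚ ≤ t → t ≤ 1ℚ → ∀ k m → m ℕ.≤ 1 →
  (1ℚ - t) ^ℚ k * (t * fromℕℚ (suc (width k m))) ≤ two
tail-bound {t} 0≤t t≤1 k m m≤1 = begin
  P * (t * fromℕℚ (suc (width k m)))
    ≤⟨ *-monoˡ P≥0 (*-monoˡ 0≤t (width-bound k m m≤1)) ⟩
  P * (t * (two * (1ℚ + e)))
    ≡⟨ solve 3 (λ P t e → P :* (t :* (con two :* (con 1ℚ :+ e))) := con two :* (P :* (t :+ e :* t))) refl P t e ⟩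
  two * (P * (t + e * t))
    ≤⟨ *-monoˡ 0≤two (*-monoˡ P≥0 (ℚP.+-monoˡ-≤ (e * t) t≤1)) ⟩
  two * (P * (1ℚ + e * t))
    ≤⟨ *-monoˡ 0≤two (bernoulli 0≤t t≤1 k) ⟩
  two * 1ℚ
    ≡⟨ ℚP.*-identityʳ two ⟩
  two ∎
  where
    open ℚP.≤-Reasoning
    P = (1ℚ - t) ^ℚ k
    e = fromℕℚ k
    P≥0 = pow-nonneg (1-nonneg t≤1) k

threshold : (ε : ℚ) → .{{ℚ.Positive ε}} → ℚ
threshold ε = two * (1/ ε) {{ℚP.pos⇒nonZero ε}} + 1ℚ

1≤threshold : ∀ ε .{{_ : ℚ.Positive ε}} → 1ℚ ≤ threshold ε
1≤threshold ε = subst (_≤ threshold ε) (ℚP.+-identityˡ 1ℚ) (ℚP.+-monoˡ-≤ 1ℚ (*-nonneg 0≤two 0≤ε⁻¹))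
  where
    instance
      ε≢0 = ℚP.pos⇒nonZero ε
    0≤ε⁻¹ : 0ℚ ≤ 1/ ε
    0≤ε⁻¹ = ℚP.<⇒≤ (ℚP.positive⁻¹ (1/ ε) {{ℚP.1/pos⇒pos ε}})

small-if-bounded : ∀ ε .{{_ : ℚ.Positive ε}} P ω → threshold ε ≤ ω → P * (ω * ω) ≤ two → P ≤ ε
small-if-bounded ε P ω M≤ω Pω²≤2 =
  ℚP.*-cancelʳ-≤-pos (ω * ω) {{ℚP.pos*pos⇒pos ω ω}} (begin
    P * (ω * ω)       ≤⟨ Pω²≤2 ⟩
    two               ≡⟨ cong (two *_) (ℚP.*-inverseʳ ε) ⟨
    two * (ε * ε⁻¹)   ≡⟨ solve 2 (λ ε i → con two :* (ε :* i) := ε :* (con two :* i)) refl ε ε⁻¹ ⟩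
    ε * (two * ε⁻¹)   ≤⟨ *-monoˡ 0≤ε (ℚP.≤-trans (≤-+-nonneg _ 0≤1) M≤ω) ⟩
    ε * ω             ≡⟨ ℚP.*-identityʳ (ε * ω) ⟨
    ε * ω * 1ℚ        ≤⟨ *-monoˡ (*-nonneg 0≤ε 0≤ω) 1≤ω ⟩
    ε * ω * ω         ≡⟨ ℚP.*-assoc ε ω ω ⟩
    ε * (ω * ω)       ∎)
  where
    open ℚP.≤-Reasoning
    instance
      ε≢0 = ℚP.pos⇒nonZero ε
    ε⁻¹ = 1/ ε
    0≤ε = ℚP.<⇒≤ (ℚP.positive⁻¹ ε)
    1≤ω : 1ℚ ≤ ω
    1≤ω = ℚP.≤-trans (1≤threshold ε) M≤ω
    0≤ω = ℚP.≤-trans 0≤1 1≤ω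
    instance
      ω-pos = ℚ.positive (ℚP.<-≤-trans (ℚP.positive⁻¹ 1ℚ) 1≤ω)

width-split : ∀ N → Σ ℕ λ k → Σ ℕ λ m → m ℕ.≤ 1 × width k m ≡ N
width-split zero          = 0 , 0 , ℕ.z≤n , refl
width-split (suc zero)    = 0 , 1 , ℕ.s≤s ℕ.z≤n , refl
width-split (suc (suc N)) =
  let (k , m , m≤1 , eq) = width-split N in suc k , m , m≤1 , cong (suc ∘ suc) eq

fixed-n : ∀ ε .{{_ : ℚ.Positive ε}} (ω : ℚ) → threshold ε ≤ ω → ∀ N (G : FinAbGroup) →
  (∀ y → _·_ G (suc N) y ≡ FinAbGroup.𝟘 G) → (θ : ℚ) → 0ℚ < θ → θ < 1ℚ →
  ω * ω ≤ θ * θ * fromℕℚ (suc N) →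
  ProbAtLeast θ N (λ A → DA≤ G A (⌊log₂ FinAbGroup.order G ⌋ ℕ.+ 1)) (1ℚ - ε)
fixed-n ε ω M≤ω N G n·G≡0 θ 0<θ θ<1 ω²≤tn with width-split N
... | k , m , m≤1 , refl =
  good k m , good-unique k m ,
  All.map (DA≤-of-complementaryPair G (suc N) n·G≡0 _) (good-pairs k m) ,
  (begin
    1ℚ - ε            ≤⟨ ℚP.+-monoʳ-≤ 1ℚ (ℚP.neg-antimono-≤ P≤ε) ⟩
    1ℚ - P            ≡⟨ sumW-good θ k m ⟨
    sumW θ (good k m) ∎)
  where
    open ℚP.≤-Reasoning
    t = θ * θ
    P = (1ℚ - t) ^ℚ k
    0≤θ = ℚP.<⇒≤ 0<θ
    -- θ² ≤ θ · 1 ≤ 1.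
    t≤1 : t ≤ 1ℚ
    t≤1 = ℚP.≤-trans (*-monoˡ 0≤θ (ℚP.<⇒≤ θ<1)) (ℚP.≤-trans (ℚP.≤-reflexive (ℚP.*-identityʳ θ)) (ℚP.<⇒≤ θ<1))
    P≤ε : P ≤ ε
    P≤ε = small-if-bounded ε P ω M≤ω
      (ℚP.≤-trans (*-monoˡ (pow-nonneg (1-nonneg t≤1) k) ω²≤tn) (tail-bound (*-nonneg 0≤θ 0≤θ) t≤1 k m m≤1))

proposition4 : (ω : ℕ → ℚ) →
    ((M : ℚ) → ∃ λ N₁ → (n : ℕ) → N₁ ℕ.≤ n → M ≤ ω n) →
    (ε : ℚ) → 0ℚ < ε →
    ∃ λ N₀ → (n : ℕ) → N₀ ℕ.≤ n →
      (G : FinAbGroup) → HasExponent G n →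
      (θ : ℚ) → 0ℚ < θ → θ < 1ℚ →
      (ω n ≤ 0ℚ ⊎ ω n * ω n ≤ θ * θ * fromℕℚ n) →
      ProbAtLeast θ (n ∸ 1)
        (λ A → DA≤ G A (⌊log₂ FinAbGroup.order G ⌋ ℕ.+ 1))
        (1ℚ - ε)
-- Choose N₀ so that ω ≥ 2/ε + 1 beyond N₀; then ω > 0 excludes the first
-- alternative, n ≥ 1 since n is an exponent, and fixed-n applies.
proposition4 ω ω→∞ ε 0<ε with ω→∞ (threshold ε {{ℚ.positive 0<ε}})
... | N₀ , M≤ω = N₀ , eventually
  where
    instance
      ε-pos = ℚ.positive 0<ε
    eventually : ∀ n → N₀ ℕ.≤ n → (G : FinAbGroup) → HasExponent G n →
      (θ : ℚ) → 0ℚ < θ → θ < 1ℚ → (ω n ≤ 0ℚ ⊎ ω n * ω n ≤ θ * θ * fromℕℚ n) →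
      ProbAtLeast θ (n ∸ 1) (λ A → DA≤ G A (⌊log₂ FinAbGroup.order G ⌋ ℕ.+ 1)) (1ℚ - ε)
    eventually zero    _    G (() , _)
    eventually (suc N) N₀≤n G (_ , n·G≡0 , _) θ 0<θ θ<1 (inj₂ ω²≤θ²n) =
      fixed-n ε (ω (suc N)) (M≤ω (suc N) N₀≤n) N G n·G≡0 θ 0<θ θ<1 ω²≤θ²n
    eventually (suc N) N₀≤n G _ θ _ _ (inj₁ ω≤0) =
      ⊥-elim (ℚP.<-irrefl refl (ℚP.<-≤-trans (ℚP.positive⁻¹ 1ℚ)
        (ℚP.≤-trans (1≤threshold ε) (ℚP.≤-trans (M≤ω (suc N) N₀≤n) ω≤0))))
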